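{- Let $A$ be an $n\times n$ irreducible, aperiodic stochastic matrix. Then the equation $AXA^*=X$ has the unique solution $X=0$ on $\mathrm{Sym}_0(\mathcal V)$.
   Context: $\mathcal V=\mathbb R^n$. $\mathrm{Sym}_0(\mathcal V)$ denotes the cone of $n\times n$ real symmetric matrices with nonnegative entries and all diagonal entries equal to zero. $A^*$ denotes the transpose of $A$. -}

module Defs where

open import Level using (0ℓ)
open import Data.Nat as ℕ using (ℕ; zero; suc)
open import Data.Nat.Divisibility using (_∣_)
open import Data.Fin using (Fin; zero; suc)
import Data.Fin
import Relation.Nullary
open import Data.Product using (Σ; _×_; ∃)
open import Relation.Binary.PropositionalEquality using (_≡_)
open import Relation.Binary.Structures using (IsTotalOrder)
open import Relation.Nullary using (¬_)
open import Algebra.Structures using (IsCommutativeRing)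

record RealField : Set₁ where
  infixl 6 _+_
  infixl 7 _*_
  infix 4 _≤_ _<_
  field
    ℝ   : Set
    _+_ _*_ : ℝ → ℝ → ℝ
    -_  : ℝ → ℝ
    0ℝ 1ℝ : ℝ
    _≤_ : ℝ → ℝ → Set
    isCommutativeRing : IsCommutativeRing _≡_ _+_ _*_ -_ 0ℝ 1ℝ
    0≢1    : ¬ (0ℝ ≡ 1ℝ)
    inverse : ∀ x → ¬ (x ≡ 0ℝ) → Σ ℝ (λ y → x * y ≡ 1ℝ)
    isTotalOrder : IsTotalOrder _≡_ _≤_
    +-mono-≤ : ∀ x y z → x ≤ y → x + z ≤ y + z
    *-nonneg : ∀ x y → 0ℝ ≤ x → 0ℝ ≤ y → 0ℝ ≤ x * y
    lub : (S : ℝ → Set) → ∃ S → (∃ λ b → ∀ x → S x → x ≤ b) →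
          Σ ℝ (λ s → (∀ x → S x → x ≤ s) × (∀ b → (∀ x → S x → x ≤ b) → s ≤ b))

  _<_ : ℝ → ℝ → Set
  x < y = (x ≤ y) × ¬ (x ≡ y)

module Matrices (𝓡 : RealField) where
  infixl 7 _⊗_
  infix 4 _≐_
  open RealField 𝓡

  Matrix : ℕ → Set
  Matrix n = Fin n → Fin n → ℝ

  sumFin : ∀ {n} → (Fin n → ℝ) → ℝ
  sumFin {zero}  f = 0ℝ
  sumFin {suc n} f = f zero + sumFin (λ k → f (suc k))

  _⊗_ : ∀ {n} → Matrix n → Matrix n → Matrix n
  (A ⊗ B) i j = sumFin (λ k → A i k * B k j)

  transpose : ∀ {n} → Matrix n → Matrix n
  transpose A i j = A j i

  identity : ∀ {n} → Matrix n
  identity i j with Data.Fin._≟_ i j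
  ... | Relation.Nullary.yes _ = 1ℝ
  ... | Relation.Nullary.no  _ = 0ℝ

  zeroMatrix : ∀ {n} → Matrix n
  zeroMatrix i j = 0ℝ

  _^_ : ∀ {n} → Matrix n → ℕ → Matrix n
  A ^ zero  = identity
  A ^ suc k = A ⊗ (A ^ k)

  Stochastic : ∀ {n} → Matrix n → Set
  Stochastic A = (∀ i j → 0ℝ ≤ A i j) × (∀ i → sumFin (A i) ≡ 1ℝ)

  Irreducible : ∀ {n} → Matrix n → Set
  Irreducible A = ∀ i j → Σ ℕ (λ k → (1 ℕ.≤ k) × (0ℝ < (A ^ k) i j))

  -- aperiodic: every state has period 1, where the period of i is
  -- gcd { k ≥ 1 : (A^k)_{ii} > 0 }; i.e. the only common divisor of all
  -- return times is 1.
  Aperiodic : ∀ {n} → Matrix n → Set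
  Aperiodic A = ∀ i (d : ℕ) →
    (∀ k → 1 ℕ.≤ k → 0ℝ < (A ^ k) i i → d ∣ k) → d ≡ 1

  Sym₀ : ∀ {n} → Matrix n → Set
  Sym₀ X = (∀ i j → X i j ≡ X j i) × (∀ i j → 0ℝ ≤ X i j) × (∀ i → X i i ≡ 0ℝ)

  _≐_ : ∀ {n} → Matrix n → Matrix n → Set
  X ≐ Y = ∀ i j → X i j ≡ Y i j

module Submission where

-- Let X ≥ 0 have zero diagonal, A X Aᵀ = X, and let M = X i₀ j₀ be
-- its largest entry.  Since A is stochastic, D = M − X is again a fixed
-- point of the congruence D ↦ A D Aᵀ, and it is nonnegative.  Expanding
-- D = Aᵃ D (Aᵃ)ᵀ, each term is at most the entry, so with D i₀ j₀ = 0 and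
-- D i₀ i₀ = M we get (Aᵃ)i₀i₀ (Aᵃ)j₀i₀ M = 0 for all a.  Irreducibility
-- and aperiodicity give walks i₀ → i₀ and j₀ → i₀ of a common length in
-- the support graph of A; cycle removal in the product graph shortens this
-- to a length a < n², so one of the finitely many weights is nonzero and M = 0.
--
-- The reals are only an ordered field here, so equality is not decidable:
-- walks are found inside the double-negation monad, and the finite bound n²
-- turns "some weight is nonzero" into the single nonzero number Σ_{a<n²}
-- weights, which can be cancelled.

open import Defs
open import Level using (0ℓ)
open import Data.Nat as ℕ using (ℕ; zero; suc)
open import Data.Nat.Divisibility using (_∣_; divides; _∣?_)
open import Data.Fin using (Fin; zero; suc; toℕ; fromℕ<; _≟_)
open import Data.Fin.Properties using (toℕ-fromℕ<)
open import Data.Product using (Σ; _×_; _,_; proj₁; proj₂; uncurry)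
open import Data.Product.Properties using (≡-dec)
open import Data.Sum using (_⊎_; inj₁; inj₂)
open import Data.Empty using (⊥-elim)
open import Effect.Monad using (RawMonad)
open import Relation.Nullary using (¬_; yes; no)
open import Relation.Nullary.Negation using (¬¬-Monad; DoubleNegation)
open import Relation.Nullary.Decidable using (¬¬-excluded-middle; decidable-stable)
open import Relation.Binary.PropositionalEquality
open import Relation.Binary.Structures using (IsTotalOrder)
open import Relation.Binary.Bundles using (Poset)
import Relation.Binary.Reasoning.PartialOrder as PosetReasoning
open import Algebra.Structures using (IsCommutativeRing)
open import Algebra.Bundles using (CommutativeRing)
import Algebra.Properties.Ring as RingProperties
import Algebra.Properties.Semiring.Sum as SemiringSum
import Algebra.Solver.CommutativeMonoid as CommutativeMonoidSolver

open RawMonad (¬¬-Monad {0ℓ}) using (return; _>>=_)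

module Walks where
  open import Data.Nat using (_+_; _*_; _≤_; _<_; s≤s; z≤n)
  open import Data.Nat.DivMod using (_%_; _/_; m≡m%n+[m/n]*n; m%n<n)
  open import Data.Nat.Induction using (<-rec)
  open import Data.Nat.Properties using (+-identityʳ)
  open import Data.Nat.Solver using (module +-*-Solver)
  open import Data.Fin using (combine)
  open import Data.Fin.Properties using (injective⇒≤; combine-injective)
  open import Data.List using (List; []; _∷_; length; lookup)
  import Data.List.Relation.Unary.All as All
  open import Data.List.Relation.Unary.All.Properties using (¬Any⇒All¬)
  open import Data.List.Relation.Unary.Any using (here; there)
  open import Data.List.Relation.Unary.Unique.Propositional using (Unique)
  open import Data.List.Relation.Unary.AllPairs using ([]; _∷_)
  open import Data.List.Membership.Propositional using (_∈_)
  open import Data.List.Membership.Propositional.Properties using (∈-lookup)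
  open import Function.Definitions using (Injective)
  open import Relation.Binary.Definitions using (DecidableEquality)

  Least : (ℕ → Set) → Set
  Least P = Σ ℕ λ c → P c × (∀ c′ → c′ < c → ¬ P c′)

  least : (P : ℕ → Set) → ∀ b → P b → DoubleNegation (Least P)
  least P = <-rec (λ b → P b → DoubleNegation (Least P)) λ b smaller pb →
    ¬¬-excluded-middle {A = Σ ℕ λ c → c < b × P c} >>= λ where
      (yes (c , c<b , pc)) → smaller c<b pc
      (no none-below)      → return (b , pb , λ c c<b pc → none-below (c , c<b , pc))

  infixr 5 _◅_

  data Walk {V : Set} (E : V → V → Set) : ℕ → V → V → Set where
    nil : ∀ {u} → Walk E 0 u u
    _◅_ : ∀ {a u v w} → E u v → Walk E a v w → Walk E (suc a) u w

  module _ {V : Set} {E : V → V → Set} where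
    infixr 5 _◅◅_

    _◅◅_ : ∀ {a b u v w} → Walk E a u v → Walk E b v w → Walk E (a + b) u w
    nil      ◅◅ W = W
    (e ◅ W₁) ◅◅ W = e ◅ (W₁ ◅◅ W)

    repeat : ∀ {t u} q → Walk E t u u → Walk E (q * t) u u
    repeat zero    W = nil
    repeat (suc q) W = W ◅◅ repeat q W

    vertices : ∀ {a u v} → Walk E a u v → List V
    vertices {u = u} nil     = u ∷ []
    vertices {u = u} (_ ◅ W) = u ∷ vertices W

    length-vertices : ∀ {a u v} (W : Walk E a u v) → length (vertices W) ≡ suc a
    length-vertices nil     = refl
    length-vertices (_ ◅ W) = cong suc (length-vertices W)

  Paired : {V : Set} → (V → V → Set) → V × V → V × V → Set
  Paired E (i , j) (p , q) = E i p × E j q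

  module _ {V : Set} {E : V → V → Set} where

    zipWalks : ∀ {a i j k l} → Walk E a i k → Walk E a j l → Walk (Paired E) a (i , j) (k , l)
    zipWalks nil      nil      = nil
    zipWalks (e ◅ W₁) (f ◅ W₂) = (e , f) ◅ zipWalks W₁ W₂

    unzipWalk : ∀ {a i j k l} → Walk (Paired E) a (i , j) (k , l) → Walk E a i k × Walk E a j l
    unzipWalk nil             = nil , nil
    unzipWalk ((e , f) ◅ W) with unzipWalk W
    ... | W₁ , W₂ = e ◅ W₁ , f ◅ W₂

  module CycleRemoval {V : Set} {E : V → V → Set} (_≟ᵥ_ : DecidableEquality V) where
    open import Data.List.Membership.DecPropositional _≟ᵥ_ using (_∈?_)

    suffixFrom : ∀ {b u v x} (W : Walk E b u v) → Unique (vertices W) → x ∈ vertices W →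
                 Σ ℕ λ b′ → Σ (Walk E b′ x v) λ W′ → Unique (vertices W′)
    suffixFrom nil     U       (here refl) = 0 , nil , U
    suffixFrom (e ◅ W) U       (here refl) = _ , e ◅ W , U
    suffixFrom (e ◅ W) (_ ∷ U) (there x∈W) = suffixFrom W U x∈W

    removeCycles : ∀ {a u v} → Walk E a u v → Σ ℕ λ b → Σ (Walk E b u v) λ W → Unique (vertices W)
    removeCycles nil = 0 , nil , (All.[] ∷ [])
    removeCycles {u = u} (e ◅ W) with removeCycles W
    ... | b , W′ , U with u ∈? vertices W′
    ...   | yes u∈W′ = suffixFrom W′ U u∈W′
    ...   | no  u∉W′ = suc b , e ◅ W′ , (¬Any⇒All¬ _ u∉W′ ∷ U)

  lookup-injective : ∀ {V : Set} {xs : List V} → Unique xs → Injective _≡_ _≡_ (lookup xs)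
  lookup-injective {xs = _ ∷ _} _        {zero}  {zero}  _ = refl
  lookup-injective {xs = _ ∷ _} (x≢ ∷ _) {zero}  {suc j} e = ⊥-elim (All.lookup x≢ (∈-lookup j) e)
  lookup-injective {xs = _ ∷ _} (x≢ ∷ _) {suc i} {zero}  e = ⊥-elim (All.lookup x≢ (∈-lookup i) (sym e))
  lookup-injective {xs = _ ∷ _} (_ ∷ U)  {suc i} {suc j} e = cong suc (lookup-injective U e)

  unique-length≤ : ∀ {V : Set} {N} (code : V → Fin N) → Injective _≡_ _≡_ code →
                   ∀ {xs} → Unique xs → length xs ≤ N
  unique-length≤ code code-inj U = injective⇒≤ (λ e → lookup-injective U (code-inj e))

  shortWalk : ∀ {V : Set} {E : V → V → Set} {N} → DecidableEquality V →
              (code : V → Fin N) → Injective _≡_ _≡_ code →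
              ∀ {a u v} → Walk E a u v → Σ ℕ λ b → b < N × Walk E b u v
  shortWalk _≟ᵥ_ code code-inj W with CycleRemoval.removeCycles _≟ᵥ_ W
  ... | b , W′ , U = b , subst (_≤ _) (length-vertices W′) (unique-length≤ code code-inj U) , W′

  pairCode : ∀ {n} → Fin n × Fin n → Fin (n * n)
  pairCode (i , j) = combine i j

  pairCode-injective : ∀ {n} → Injective _≡_ _≡_ (pairCode {n})
  pairCode-injective {x = i , j} {k , l} e = uncurry (cong₂ _,_) (combine-injective i j k l e)

  -- Aperiodicity at a vertex i₀: the only common divisor of all return times
  -- to i₀ is 1.  Fixing one closed walk at i₀ of positive length p = suc r,
  -- there are (classically) closed walks at i₀ of every length ≡ 1 (mod p),
  -- and this lets any walk into i₀ be matched by a closed walk of equal length.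
  module Aperiodicity {V : Set} {E : V → V → Set} {i₀ : V} (r : ℕ) (cycle : Walk E (suc r) i₀ i₀)
                      (aperiodic : ∀ d → (∀ k → Walk E k i₀ i₀ → d ∣ k) → d ≡ 1) where
    open +-*-Solver

    p : ℕ
    p = suc r

    Residue : ℕ → Set
    Residue c = 1 ≤ c × Σ ℕ λ Q → Walk E (c + Q * p) i₀ i₀

    residue-p : Residue p
    residue-p = s≤s z≤n , 0 , subst (λ t → Walk E t i₀ i₀) (sym (+-identityʳ p)) cycle

    -- the length of the closed walk W ◅◅ repeat (q * r) Wc used below
    residue-arith : ∀ ρ q c Q → (ρ + q * c) + q * r * (c + Q * p) ≡ ρ + (q * c + q * r * Q) * p
    residue-arith ρ q c Q = solve 5 (λ ρ q c Q r → (ρ :+ q :* c) :+ q :* r :* (c :+ Q :* (con 1 :+ r))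
                                       := ρ :+ (q :* c :+ q :* r :* Q) :* (con 1 :+ r)) refl ρ q c Q r

    -- The least positive residue c divides every return time t: writing
    -- t = ρ + q c with 0 < ρ < c, the walk of length t followed by q r
    -- copies of the walk of length c + Q p has residue ρ, contradicting minimality.
    least-divides : ∀ {c} → Residue c → (∀ c′ → c′ < c → ¬ Residue c′) →
                    ∀ t → Walk E t i₀ i₀ → c ∣ t
    least-divides {suc c′} (_ , Q , Wc) minimal t W
      with t % suc c′ | m≡m%n+[m/n]*n t (suc c′) | m%n<n t (suc c′)
    ... | zero  | t≡qc  | _   = divides (t / suc c′) t≡qc
    ... | suc ρ | t≡ρqc | ρ<c = ⊥-elim (minimal (suc ρ) ρ<c (s≤s z≤n , Q′ , shorter))
      where
        q = t / suc c′
        Q′ = q * suc c′ + q * r * Q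
        total-length : t + q * r * (suc c′ + Q * p) ≡ suc ρ + Q′ * p
        total-length = trans (cong (λ t → t + q * r * (suc c′ + Q * p)) t≡ρqc)
                             (residue-arith (suc ρ) q (suc c′) Q)
        shorter : Walk E (suc ρ + Q′ * p) i₀ i₀
        shorter = subst (λ l → Walk E l i₀ i₀) total-length (W ◅◅ repeat (q * r) Wc)

    residue-one : DoubleNegation (Residue 1)
    residue-one = least Residue p residue-p >>= λ (c , residue-c , minimal) →
      return (subst Residue (aperiodic c (least-divides residue-c minimal)) residue-c)

    synchronise-arith : ∀ m Q → m * (1 + Q * p) ≡ m + m * Q * p
    synchronise-arith m Q = solve 3 (λ m Q r → m :* (con 1 :+ Q :* (con 1 :+ r))
                                             := m :+ m :* Q :* (con 1 :+ r)) refl m Q r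

    -- A walk j₀ → i₀ of length m and a closed walk of length 1 + Q p give walks
    -- i₀ → i₀ and j₀ → i₀ of the common length m (1 + Q p).
    synchronise : ∀ {j₀ m} → Walk E m j₀ i₀ →
                  DoubleNegation (Σ ℕ λ t → Walk E t i₀ i₀ × Walk E t j₀ i₀)
    synchronise {j₀} {m} path = residue-one >>= λ (_ , Q , W₁) →
      return (m * (1 + Q * p) , repeat m W₁ ,
              subst (λ l → Walk E l j₀ i₀) (sym (synchronise-arith m Q)) (path ◅◅ repeat (m * Q) cycle))

open Walks

module OrderedField (𝓡 : RealField) where
  open RealField 𝓡 public
  open IsCommutativeRing isCommutativeRing public
    using (+-assoc; +-comm; *-assoc; *-comm; +-identityˡ; +-identityʳ; *-identityˡ;
           -‿inverseˡ; -‿inverseʳ; distribˡ; zeroˡ; zeroʳ)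
  open IsTotalOrder isTotalOrder public
    using (total; antisym) renaming (trans to ≤-trans; refl to ≤-refl; reflexive to ≤-reflexive)

  ℝ-ring : CommutativeRing 0ℓ 0ℓ
  ℝ-ring = record { isCommutativeRing = isCommutativeRing }

  open RingProperties (CommutativeRing.ring ℝ-ring) public
    using (-‿distribˡ-*; -‿distribʳ-*; -‿involutive; -‿anti-homo-+; -0#≈0#)

  ℝ-poset : Poset 0ℓ 0ℓ 0ℓ
  ℝ-poset = record { isPartialOrder = IsTotalOrder.isPartialOrder isTotalOrder }

  module ≤-Reasoning = PosetReasoning ℝ-poset

  module ×-Solver = CommutativeMonoidSolver (CommutativeRing.*-commutativeMonoid ℝ-ring)

  infixl 6 _-_
  _-_ : ℝ → ℝ → ℝ
  x - y = x + - y

  +-monoʳ-≤ : ∀ z {x y} → x ≤ y → z + x ≤ z + y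
  +-monoʳ-≤ z {x} {y} x≤y = subst₂ _≤_ (+-comm x z) (+-comm y z) (+-mono-≤ x y z x≤y)

  +-mono₂-≤ : ∀ {a b c d} → a ≤ b → c ≤ d → a + c ≤ b + d
  +-mono₂-≤ {a} {b} {c} {d} a≤b c≤d = ≤-trans (+-mono-≤ a b c a≤b) (+-monoʳ-≤ b c≤d)

  x≤x+y : ∀ {x y} → 0ℝ ≤ y → x ≤ x + y
  x≤x+y {x} {y} 0≤y = subst (_≤ x + y) (+-identityʳ x) (+-monoʳ-≤ x 0≤y)

  y≤x+y : ∀ {x y} → 0ℝ ≤ x → y ≤ x + y
  y≤x+y {x} {y} 0≤x = subst (_≤ x + y) (+-identityˡ y) (+-mono-≤ 0ℝ x y 0≤x)

  x≤y⇒0≤y-x : ∀ {x y} → x ≤ y → 0ℝ ≤ y - x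
  x≤y⇒0≤y-x {x} {y} x≤y = subst (_≤ y - x) (-‿inverseʳ x) (+-mono-≤ x y (- x) x≤y)

  0≤y-x⇒x≤y : ∀ {x y} → 0ℝ ≤ y - x → x ≤ y
  0≤y-x⇒x≤y {x} {y} 0≤y-x = subst₂ _≤_ (+-identityˡ x) y-x+x≡y (+-mono-≤ 0ℝ (y - x) x 0≤y-x)
    where
      y-x+x≡y : y - x + x ≡ y
      y-x+x≡y = trans (+-assoc y (- x) x) (trans (cong (y +_) (-‿inverseˡ x)) (+-identityʳ y))

  *-monoʳ-≤ : ∀ {c x y} → 0ℝ ≤ c → x ≤ y → c * x ≤ c * y
  *-monoʳ-≤ {c} {x} {y} 0≤c x≤y =
    0≤y-x⇒x≤y (subst (0ℝ ≤_) c[y-x]≡cy-cx (*-nonneg c (y - x) 0≤c (x≤y⇒0≤y-x x≤y)))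
    where
      c[y-x]≡cy-cx : c * (y - x) ≡ c * y - c * x
      c[y-x]≡cy-cx = trans (distribˡ c y (- x)) (cong (c * y +_) (sym (-‿distribʳ-* c x)))

  -- if 1 ≤ 0 then 0 ≤ -1, and 1 = (-1)(-1) is nonnegative after all
  0≤1 : 0ℝ ≤ 1ℝ
  0≤1 with total 0ℝ 1ℝ
  ... | inj₁ 0≤1 = 0≤1
  ... | inj₂ 1≤0 = subst (0ℝ ≤_) [-1][-1]≡1 (*-nonneg (- 1ℝ) (- 1ℝ) 0≤-1 0≤-1)
    where
      0≤-1 : 0ℝ ≤ - 1ℝ
      0≤-1 = subst₂ _≤_ (-‿inverseʳ 1ℝ) (+-identityˡ (- 1ℝ)) (+-mono-≤ 1ℝ 0ℝ (- 1ℝ) 1≤0)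
      [-1][-1]≡1 : - 1ℝ * - 1ℝ ≡ 1ℝ
      [-1][-1]≡1 = trans (sym (-‿distribˡ-* 1ℝ (- 1ℝ)))
                         (trans (cong -_ (*-identityˡ (- 1ℝ))) (-‿involutive 1ℝ))

  *-cancelˡ-zero : ∀ {a b} → ¬ (a ≡ 0ℝ) → a * b ≡ 0ℝ → b ≡ 0ℝ
  *-cancelˡ-zero {a} {b} a≢0 ab≡0 with inverse a a≢0
  ... | a⁻¹ , aa⁻¹≡1 = begin
      b              ≡⟨ sym (*-identityˡ b) ⟩
      1ℝ * b         ≡⟨ cong (_* b) (trans (sym aa⁻¹≡1) (*-comm a a⁻¹)) ⟩
      a⁻¹ * a * b    ≡⟨ *-assoc a⁻¹ a b ⟩
      a⁻¹ * (a * b)  ≡⟨ cong (a⁻¹ *_) ab≡0 ⟩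
      a⁻¹ * 0ℝ       ≡⟨ zeroʳ a⁻¹ ⟩
      0ℝ             ∎
    where open ≡-Reasoning

  *-≢0 : ∀ {a b} → ¬ (a ≡ 0ℝ) → ¬ (b ≡ 0ℝ) → ¬ (a * b ≡ 0ℝ)
  *-≢0 a≢0 b≢0 ab≡0 = b≢0 (*-cancelˡ-zero a≢0 ab≡0)

  ≢0-factorˡ : ∀ {a b} → ¬ (a * b ≡ 0ℝ) → ¬ (a ≡ 0ℝ)
  ≢0-factorˡ {a} {b} ab≢0 a≡0 = ab≢0 (trans (cong (_* b) a≡0) (zeroˡ b))

  ≢0-factorʳ : ∀ {a b} → ¬ (a * b ≡ 0ℝ) → ¬ (b ≡ 0ℝ)
  ≢0-factorʳ {a} {b} ab≢0 b≡0 = ab≢0 (trans (cong (a *_) b≡0) (zeroʳ a))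

  ≢0-above : ∀ {a b} → 0ℝ ≤ a → ¬ (a ≡ 0ℝ) → a ≤ b → ¬ (b ≡ 0ℝ)
  ≢0-above 0≤a a≢0 a≤b b≡0 = a≢0 (antisym (subst (_ ≤_) b≡0 a≤b) 0≤a)

  >0⇒≢0 : ∀ {x} → 0ℝ < x → ¬ (x ≡ 0ℝ)
  >0⇒≢0 (_ , 0≢x) x≡0 = 0≢x (sym x≡0)

  factor-zero : ∀ {u v w} → u ≡ 0ℝ ⊎ v ≡ 0ℝ → u * v * w ≡ 0ℝ
  factor-zero {u} {v} {w} (inj₁ u≡0) = trans (cong (λ x → x * v * w) u≡0) (trans (cong (_* w) (zeroˡ v)) (zeroˡ w))
  factor-zero {u} {v} {w} (inj₂ v≡0) = trans (cong (λ x → u * x * w) v≡0) (trans (cong (_* w) (zeroʳ u)) (zeroˡ w))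

module FiniteSums (𝓡 : RealField) where
  open OrderedField 𝓡
  open Matrices 𝓡 using (sumFin)
  open SemiringSum (CommutativeRing.semiring ℝ-ring)
    using (sum; sum-cong-≗; sum-replicate-zero; ∑-distrib-+; *-distribˡ-sum; *-distribʳ-sum)

  sumFin≡sum : ∀ {n} (f : Fin n → ℝ) → sumFin f ≡ sum f
  sumFin≡sum {zero}  f = refl
  sumFin≡sum {suc n} f = cong (f zero +_) (sumFin≡sum (λ k → f (suc k)))

  sum-cong : ∀ {n} {f g : Fin n → ℝ} → (∀ k → f k ≡ g k) → sumFin f ≡ sumFin g
  sum-cong {f = f} {g} f≗g = trans (sumFin≡sum f) (trans (sum-cong-≗ f≗g) (sym (sumFin≡sum g)))

  sum-zero : ∀ {n} → sumFin {n} (λ _ → 0ℝ) ≡ 0ℝ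
  sum-zero {n} = trans (sumFin≡sum {n} _) (sum-replicate-zero n)

  sum-+ : ∀ {n} (f g : Fin n → ℝ) → sumFin (λ k → f k + g k) ≡ sumFin f + sumFin g
  sum-+ f g = trans (sumFin≡sum (λ k → f k + g k))
                    (trans (∑-distrib-+ f g) (sym (cong₂ _+_ (sumFin≡sum f) (sumFin≡sum g))))

  *-distribˡ-sumFin : ∀ {n} c (f : Fin n → ℝ) → c * sumFin f ≡ sumFin (λ k → c * f k)
  *-distribˡ-sumFin c f = trans (cong (c *_) (sumFin≡sum f))
                                (trans (*-distribˡ-sum c f) (sym (sumFin≡sum (λ k → c * f k))))

  *-distribʳ-sumFin : ∀ {n} c (f : Fin n → ℝ) → sumFin f * c ≡ sumFin (λ k → f k * c)
  *-distribʳ-sumFin c f = trans (cong (_* c) (sumFin≡sum f))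
                                (trans (*-distribʳ-sum c f) (sym (sumFin≡sum (λ k → f k * c))))

  sum-neg : ∀ {n} (f : Fin n → ℝ) → sumFin (λ k → - f k) ≡ - sumFin f
  sum-neg {zero}  f = sym -0#≈0#
  sum-neg {suc n} f = trans (cong (- f zero +_) (sum-neg (λ k → f (suc k))))
                            (trans (+-comm _ _) (sym (-‿anti-homo-+ (f zero) _)))

  sum-- : ∀ {n} (f g : Fin n → ℝ) → sumFin (λ k → f k - g k) ≡ sumFin f - sumFin g
  sum-- f g = trans (sum-+ f (λ k → - g k)) (cong (sumFin f +_) (sum-neg g))

  sum-*-sum : ∀ {n} (f g : Fin n → ℝ) c →
              sumFin f * sumFin g * c ≡ sumFin (λ q → sumFin (λ p → f p * g q * c))
  sum-*-sum f g c = begin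
    sumFin f * sumFin g * c              ≡⟨ cong (_* c) (*-distribˡ-sumFin (sumFin f) g) ⟩
    sumFin (λ q → sumFin f * g q) * c    ≡⟨ *-distribʳ-sumFin c (λ q → sumFin f * g q) ⟩
    sumFin (λ q → sumFin f * g q * c)    ≡⟨ sum-cong (λ q → cong (_* c) (*-distribʳ-sumFin (g q) f)) ⟩
    sumFin (λ q → sumFin (λ p → f p * g q) * c)
                                         ≡⟨ sum-cong (λ q → *-distribʳ-sumFin c (λ p → f p * g q)) ⟩
    sumFin (λ q → sumFin (λ p → f p * g q * c)) ∎
    where open ≡-Reasoning

  sum-mono : ∀ {n} {f g : Fin n → ℝ} → (∀ k → f k ≤ g k) → sumFin f ≤ sumFin g
  sum-mono {zero}  f≤g = ≤-refl
  sum-mono {suc n} f≤g = +-mono₂-≤ (f≤g zero) (sum-mono (λ k → f≤g (suc k)))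

  sum-nonneg : ∀ {n} {f : Fin n → ℝ} → (∀ k → 0ℝ ≤ f k) → 0ℝ ≤ sumFin f
  sum-nonneg {n} {f} 0≤f = subst (_≤ sumFin f) (sum-zero {n}) (sum-mono 0≤f)

  term≤sum : ∀ {n} {f : Fin n → ℝ} → (∀ k → 0ℝ ≤ f k) → ∀ k → f k ≤ sumFin f
  term≤sum {suc n} 0≤f zero    = x≤x+y (sum-nonneg (λ k → 0≤f (suc k)))
  term≤sum {suc n} 0≤f (suc k) = ≤-trans (term≤sum (λ k → 0≤f (suc k)) k) (y≤x+y (0≤f zero))

  sum≢0⇒term≢0 : ∀ {n} (f : Fin n → ℝ) → ¬ (sumFin f ≡ 0ℝ) → ¬ ¬ (Σ (Fin n) λ k → ¬ (f k ≡ 0ℝ))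
  sum≢0⇒term≢0 {zero}  f sum≢0 _ = sum≢0 refl
  sum≢0⇒term≢0 {suc n} f sum≢0 none = none (zero , λ head≡0 →
    sum≢0⇒term≢0 (λ k → f (suc k))
      (λ tail≡0 → sum≢0 (trans (cong₂ _+_ head≡0 tail≡0) (+-identityʳ 0ℝ)))
      (λ (k , fk≢0) → none (suc k , fk≢0)))

  -- The constructive core of the proof: if c kills every term of a finite
  -- family of nonnegative numbers, not all zero, then c = 0.  Summing
  -- turns the classical "some term is nonzero" into one nonzero number.
  annihilator-zero : ∀ {N} (f : Fin N → ℝ) (c : ℝ) → (∀ k → 0ℝ ≤ f k) →
                     (∀ k → f k * c ≡ 0ℝ) → ¬ ¬ (Σ (Fin N) λ k → ¬ (f k ≡ 0ℝ)) → c ≡ 0ℝ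
  annihilator-zero {N} f c 0≤f fc≡0 someTerm≢0 = *-cancelˡ-zero sum≢0 sum*c≡0
    where
      sum≢0 : ¬ (sumFin f ≡ 0ℝ)
      sum≢0 sum≡0 = someTerm≢0 λ (k , fk≢0) →
        fk≢0 (antisym (subst (f k ≤_) sum≡0 (term≤sum 0≤f k)) (0≤f k))
      sum*c≡0 : sumFin f * c ≡ 0ℝ
      sum*c≡0 = trans (*-distribʳ-sumFin c f) (trans (sum-cong fc≡0) (sum-zero {N}))

module NonnegativeMatrices (𝓡 : RealField) where
  open OrderedField 𝓡
  open FiniteSums 𝓡
  open Matrices 𝓡

  identity-cases : ∀ {n} (i k : Fin n) → (i ≡ k × identity i k ≡ 1ℝ) ⊎ (¬ i ≡ k × identity i k ≡ 0ℝ)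
  identity-cases i k with i ≟ k
  ... | yes i≡k = inj₁ (i≡k , refl)
  ... | no  i≢k = inj₂ (i≢k , refl)

  power-nonneg : ∀ {n} {A : Matrix n} → (∀ i j → 0ℝ ≤ A i j) → ∀ a i k → 0ℝ ≤ (A ^ a) i k
  power-nonneg A≥0 zero i k with identity-cases i k
  ... | inj₁ (_ , Iik≡1) = subst (0ℝ ≤_) (sym Iik≡1) 0≤1
  ... | inj₂ (_ , Iik≡0) = ≤-reflexive (sym Iik≡0)
  power-nonneg A≥0 (suc a) i k = sum-nonneg (λ p → *-nonneg _ _ (A≥0 i p) (power-nonneg A≥0 a p k))

  congruence-entry : ∀ {n} (A B D : Matrix n) i j →
    ((A ⊗ D) ⊗ transpose B) i j ≡ sumFin (λ q → sumFin (λ p → A i p * B j q * D p q))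
  congruence-entry A B D i j = sum-cong λ q →
    trans (*-distribʳ-sumFin (B j q) (λ p → A i p * D p q))
          (sum-cong λ p → swap₂₃ (A i p) (D p q) (B j q))
    where
      swap₂₃ : ∀ a b c → a * b * c ≡ a * c * b
      swap₂₃ = ×-Solver.solve 3 (λ a b c → (a ⊕ b) ⊕ c ⊜ (a ⊕ c) ⊕ b) refl
        where open ×-Solver

  congruence-zero : ∀ {n} (A : Matrix n) → (A ⊗ zeroMatrix) ⊗ transpose A ≐ zeroMatrix
  congruence-zero {n} A i j = trans (congruence-entry A A zeroMatrix i j)
    (trans (sum-cong λ q → trans (sum-cong λ p → zeroʳ (A i p * A j q)) (sum-zero {n})) (sum-zero {n}))

  fixedPoint-dominates : ∀ {n} {A D : Matrix n} → (∀ i j → 0ℝ ≤ A i j) → (∀ i j → 0ℝ ≤ D i j) →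
    (A ⊗ D) ⊗ transpose A ≐ D → ∀ a i j k l → (A ^ a) i k * (A ^ a) j l * D k l ≤ D i j
  fixedPoint-dominates {A = A} {D} A≥0 D≥0 fixed = dominates
    where
      rearrange : ∀ a b c d e → a * b * (c * d) * e ≡ a * c * (b * d * e)
      rearrange = ×-Solver.solve 5 (λ a b c d e → ((a ⊕ b) ⊕ (c ⊕ d)) ⊕ e ⊜ (a ⊕ c) ⊕ ((b ⊕ d) ⊕ e)) refl
        where open ×-Solver

      dominates : ∀ a i j k l → (A ^ a) i k * (A ^ a) j l * D k l ≤ D i j
      dominates zero i j k l with identity-cases i k | identity-cases j l
      ... | inj₁ (refl , Iik≡1) | inj₁ (refl , Ijl≡1) = ≤-reflexive (begin
            identity i i * identity j j * D i j  ≡⟨ cong₂ (λ u v → u * v * D i j) Iik≡1 Ijl≡1 ⟩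
            1ℝ * 1ℝ * D i j                      ≡⟨ cong (_* D i j) (*-identityˡ 1ℝ) ⟩
            1ℝ * D i j                           ≡⟨ *-identityˡ (D i j) ⟩
            D i j                                ∎)
        where open ≡-Reasoning
      ... | inj₂ (_ , Iik≡0) | _               = subst (_≤ D i j) (sym (factor-zero (inj₁ Iik≡0))) (D≥0 i j)
      ... | inj₁ _           | inj₂ (_ , Ijl≡0) = subst (_≤ D i j) (sym (factor-zero (inj₂ Ijl≡0))) (D≥0 i j)
      dominates (suc a) i j k l = begin
        (A ^ suc a) i k * (A ^ suc a) j l * D k l
          ≡⟨ sum-*-sum (λ p → A i p * (A ^ a) p k) (λ q → A j q * (A ^ a) q l) (D k l) ⟩
        sumFin (λ q → sumFin (λ p → A i p * (A ^ a) p k * (A j q * (A ^ a) q l) * D k l))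
          ≡⟨ sum-cong (λ q → sum-cong λ p → rearrange (A i p) ((A ^ a) p k) (A j q) ((A ^ a) q l) (D k l)) ⟩
        sumFin (λ q → sumFin (λ p → A i p * A j q * ((A ^ a) p k * (A ^ a) q l * D k l)))
          ≤⟨ sum-mono (λ q → sum-mono λ p →
               *-monoʳ-≤ (*-nonneg _ _ (A≥0 i p) (A≥0 j q)) (dominates a p q k l)) ⟩
        sumFin (λ q → sumFin (λ p → A i p * A j q * D p q))
          ≡⟨ sym (congruence-entry A A D i j) ⟩
        ((A ⊗ D) ⊗ transpose A) i j
          ≡⟨ fixed i j ⟩
        D i j ∎
        where open ≤-Reasoning

  -- A stochastic matrix fixes every constant matrix under the congruence;
  -- hence whenever it fixes X, it also fixes c − X.
  complement-fixed : ∀ {n} {A X : Matrix n} → (∀ i → sumFin (A i) ≡ 1ℝ) →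
    (A ⊗ X) ⊗ transpose A ≐ X → ∀ c → (A ⊗ (λ k l → c - X k l)) ⊗ transpose A ≐ (λ k l → c - X k l)
  complement-fixed {A = A} {X} rows fixed c i j = begin
    ((A ⊗ C) ⊗ transpose A) i j
      ≡⟨ congruence-entry A A C i j ⟩
    sumFin (λ q → sumFin (λ p → A i p * A j q * (c - X p q)))
      ≡⟨ sum-cong (λ q → sum-cong λ p → distrib-- (A i p * A j q) c (X p q)) ⟩
    sumFin (λ q → sumFin (λ p → A i p * A j q * c - A i p * A j q * X p q))
      ≡⟨ sum-cong (λ q → sum-- (λ p → A i p * A j q * c) (λ p → A i p * A j q * X p q)) ⟩
    sumFin (λ q → sumFin (λ p → A i p * A j q * c) - sumFin (λ p → A i p * A j q * X p q))
      ≡⟨ sum-- (λ q → sumFin (λ p → A i p * A j q * c)) (λ q → sumFin (λ p → A i p * A j q * X p q)) ⟩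
    sumFin (λ q → sumFin (λ p → A i p * A j q * c)) - sumFin (λ q → sumFin (λ p → A i p * A j q * X p q))
      ≡⟨ cong₂ _-_ constant-fixed (trans (sym (congruence-entry A A X i j)) (fixed i j)) ⟩
    c - X i j ∎
    where
      open ≡-Reasoning
      C : Matrix _
      C k l = c - X k l
      distrib-- : ∀ a x y → a * (x - y) ≡ a * x - a * y
      distrib-- a x y = trans (distribˡ a x (- y)) (cong (a * x +_) (sym (-‿distribʳ-* a y)))
      constant-fixed : sumFin (λ q → sumFin (λ p → A i p * A j q * c)) ≡ c
      constant-fixed = begin
        sumFin (λ q → sumFin (λ p → A i p * A j q * c)) ≡⟨ sym (sum-*-sum (A i) (A j) c) ⟩
        sumFin (A i) * sumFin (A j) * c                 ≡⟨ cong₂ (λ u v → u * v * c) (rows i) (rows j) ⟩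
        1ℝ * 1ℝ * c                                     ≡⟨ trans (cong (_* c) (*-identityˡ 1ℝ)) (*-identityˡ c) ⟩
        c                                               ∎

  argmax : ∀ {n} (f : Fin (suc n) → ℝ) → Σ (Fin (suc n)) λ i → ∀ j → f j ≤ f i
  argmax {zero}  f = zero , λ { zero → ≤-refl }
  argmax {suc n} f with argmax (λ k → f (suc k))
  ... | i , f≤fsi with total (f zero) (f (suc i))
  ...   | inj₁ f0≤fsi = suc i , λ { zero → f0≤fsi ; (suc j) → f≤fsi j }
  ...   | inj₂ fsi≤f0 = zero  , λ { zero → ≤-refl ; (suc j) → ≤-trans (f≤fsi j) fsi≤f0 }

  matrix-max : ∀ {n} (X : Matrix (suc n)) →
               Σ (Fin (suc n)) λ i₀ → Σ (Fin (suc n)) λ j₀ → ∀ i j → X i j ≤ X i₀ j₀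
  matrix-max {n} X =
    i₀ , column i₀ , λ i j → ≤-trans (proj₂ (argmax (X i)) j) (proj₂ (argmax rowMaximum) i)
    where
      column : Fin (suc n) → Fin (suc n)
      column i = proj₁ (argmax (X i))
      rowMaximum : Fin (suc n) → ℝ
      rowMaximum i = X i (column i)
      i₀ : Fin (suc n)
      i₀ = proj₁ (argmax rowMaximum)

module SupportGraph (𝓡 : RealField) {n} (A : Matrices.Matrix 𝓡 n) where
  open OrderedField 𝓡
  open FiniteSums 𝓡
  open Matrices 𝓡
  open NonnegativeMatrices 𝓡

  Edge : Fin n → Fin n → Set
  Edge i j = ¬ (A i j ≡ 0ℝ)

  walk⇒power≢0 : (∀ i j → 0ℝ ≤ A i j) → ∀ {a i k} → Walk Edge a i k → ¬ ((A ^ a) i k ≡ 0ℝ)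
  walk⇒power≢0 A≥0 {i = i} nil with identity-cases i i
  ... | inj₁ (_ , Iii≡1) = λ Iii≡0 → 0≢1 (trans (sym Iii≡0) Iii≡1)
  ... | inj₂ (i≢i , _)   = ⊥-elim (i≢i refl)
  walk⇒power≢0 A≥0 {suc a} {i} {k} (_◅_ {v = v} Aiv≢0 W) =
    ≢0-above (term≥0 v) (*-≢0 Aiv≢0 (walk⇒power≢0 A≥0 W)) (term≤sum term≥0 v)
    where
      term≥0 : ∀ p → 0ℝ ≤ A i p * (A ^ a) p k
      term≥0 p = *-nonneg _ _ (A≥0 i p) (power-nonneg A≥0 a p k)

  power≢0⇒walk : ∀ a i k → ¬ ((A ^ a) i k ≡ 0ℝ) → DoubleNegation (Walk Edge a i k)
  power≢0⇒walk zero i k Iik≢0 with identity-cases i k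
  ... | inj₁ (refl , _)   = return nil
  ... | inj₂ (_ , Iik≡0) = ⊥-elim (Iik≢0 Iik≡0)
  power≢0⇒walk (suc a) i k entry≢0 = do
    (p , term≢0) ← sum≢0⇒term≢0 (λ p → A i p * (A ^ a) p k) entry≢0
    W ← power≢0⇒walk a p k (≢0-factorʳ term≢0)
    return (≢0-factorˡ term≢0 ◅ W)

  aperiodic-walks : Aperiodic A → ∀ i d → (∀ k → Walk Edge k i i → d ∣ k) → d ≡ 1
  aperiodic-walks aper i d d∣walks = aper i d λ k _ Aᵏii>0 →
    decidable-stable (d ∣? k) (power≢0⇒walk k i i (>0⇒≢0 Aᵏii>0) >>= λ W →
                               return (d∣walks k W))

  -- For irreducible aperiodic A ≥ 0, any two states j₀ and i₀ reach i₀ in the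
  -- same number a < n² of steps: synchronise the two walks using aperiodicity,
  -- then shorten the resulting walk in the product graph on n² vertices.
  meeting : (∀ i j → 0ℝ ≤ A i j) → Irreducible A → Aperiodic A → ∀ i₀ j₀ →
    DoubleNegation (Σ (Fin (n ℕ.* n)) λ a → ¬ ((A ^ toℕ a) i₀ i₀ * (A ^ toℕ a) j₀ i₀ ≡ 0ℝ))
  meeting A≥0 irr aper i₀ j₀ with irr i₀ i₀ | irr j₀ i₀
  ... | zero , () , _ | _
  ... | suc r , _ , cycle>0 | m , _ , path>0 = do
    cycle ← power≢0⇒walk (suc r) i₀ i₀ (>0⇒≢0 cycle>0)
    path  ← power≢0⇒walk m j₀ i₀ (>0⇒≢0 path>0)
    (_ , W₁ , W₂) ← Aperiodicity.synchronise r cycle (aperiodic-walks aper i₀) path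
    let (b , b<n² , W) = shortWalk (≡-dec _≟_ _≟_) pairCode pairCode-injective (zipWalks W₁ W₂)
        (V₁ , V₂) = unzipWalk W
    return (fromℕ< b<n² , subst (λ b → ¬ ((A ^ b) i₀ i₀ * (A ^ b) j₀ i₀ ≡ 0ℝ))
                                (sym (toℕ-fromℕ< b<n²))
                                (*-≢0 (walk⇒power≢0 A≥0 V₁) (walk⇒power≢0 A≥0 V₂)))

module FixedPoints (𝓡 : RealField) where
  open OrderedField 𝓡
  open FiniteSums 𝓡
  open Matrices 𝓡
  open NonnegativeMatrices 𝓡

  -- With M = X i₀ j₀ the largest entry, D = M − X ≥ 0 is also fixed and has
  -- D i₀ j₀ = 0, D i₀ i₀ = M; so every meeting weight (Aᵃ)i₀i₀ (Aᵃ)j₀i₀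
  -- annihilates M, and some such weight with a < n² is nonzero.
  fixedPoint-zero : ∀ {n} (A X : Matrix n) → Stochastic A → Irreducible A → Aperiodic A →
    (∀ i j → 0ℝ ≤ X i j) → (∀ i → X i i ≡ 0ℝ) → (A ⊗ X) ⊗ transpose A ≐ X → X ≐ zeroMatrix
  fixedPoint-zero {zero}  A X _ _ _ _ _ _ ()
  fixedPoint-zero {suc n} A X (A≥0 , rows) irr aper X≥0 diag fixed i j =
    antisym (subst (X i j ≤_) M≡0 (X≤M i j)) (X≥0 i j)
    where
      open SupportGraph 𝓡 A using (meeting)

      i₀ j₀ : Fin (suc n)
      i₀ = proj₁ (matrix-max X)
      j₀ = proj₁ (proj₂ (matrix-max X))

      M : ℝ
      M = X i₀ j₀

      X≤M : ∀ k l → X k l ≤ M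
      X≤M = proj₂ (proj₂ (matrix-max X))

      D : Matrix (suc n)
      D k l = M - X k l

      weight : ℕ → ℝ
      weight a = (A ^ a) i₀ i₀ * (A ^ a) j₀ i₀

      weight≥0 : ∀ a → 0ℝ ≤ weight a
      weight≥0 a = *-nonneg _ _ (power-nonneg A≥0 a i₀ i₀) (power-nonneg A≥0 a j₀ i₀)

      -- the bound weight a * D i₀ i₀ ≤ D i₀ j₀, read as weight a * M ≤ 0
      weight-annihilates : ∀ a → weight a * M ≡ 0ℝ
      weight-annihilates a = antisym (subst₂ (λ u v → weight a * u ≤ v) Dii≡M (-‿inverseʳ M) bound)
                                     (*-nonneg _ _ (weight≥0 a) (X≥0 i₀ j₀))
        where
          bound : weight a * D i₀ i₀ ≤ D i₀ j₀
          bound = fixedPoint-dominates A≥0 (λ k l → x≤y⇒0≤y-x (X≤M k l)) (complement-fixed {A = A} rows fixed M) a i₀ j₀ i₀ i₀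
          Dii≡M : D i₀ i₀ ≡ M
          Dii≡M = trans (cong (λ x → M - x) (diag i₀)) (trans (cong (M +_) -0#≈0#) (+-identityʳ M))

      M≡0 : M ≡ 0ℝ
      M≡0 = annihilator-zero (λ a → weight (toℕ a)) M (λ a → weight≥0 (toℕ a))
                             (λ a → weight-annihilates (toℕ a)) (meeting A≥0 irr aper i₀ j₀)

mainTheorem6 : (𝓡 : RealField) → let open Matrices 𝓡 in
    (n : ℕ) (A : Matrix n) → Stochastic A → Irreducible A → Aperiodic A →
    (Sym₀ (zeroMatrix {n}) × ((A ⊗ zeroMatrix) ⊗ transpose A ≐ zeroMatrix))
    × ((X : Matrix n) → Sym₀ X → (A ⊗ X) ⊗ transpose A ≐ X → X ≐ zeroMatrix)
mainTheorem6 𝓡 n A stochastic irreducible aperiodic = (zero-in-Sym₀ , congruence-zero A) , uniqueness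
  where
    open OrderedField 𝓡 using (≤-refl)
    open Matrices 𝓡
    open NonnegativeMatrices 𝓡 using (congruence-zero)
    open FixedPoints 𝓡 using (fixedPoint-zero)

    zero-in-Sym₀ : Sym₀ (zeroMatrix {n})
    zero-in-Sym₀ = (λ _ _ → refl) , (λ _ _ → ≤-refl) , (λ _ → refl)

    uniqueness : (X : Matrix n) → Sym₀ X → (A ⊗ X) ⊗ transpose A ≐ X → X ≐ zeroMatrix
    uniqueness X (_ , X≥0 , zero-diagonal) =
      fixedPoint-zero A X stochastic irreducible aperiodic X≥0 zero-diagonal
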